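{- Let $m\ge 3$ be an odd integer and let $v\in\mathbb{F}_{2^{2m}}^*$ be a non-cube in $\mathbb{F}_{2^{2m}}^*$ with $v^{2^m+1}=1$. Then the monomial $v\,x^{2^{2m-1}+2^m+2^{m-1}-1}$ is a complete permutation polynomial over $\mathbb{F}_{2^{2m}}$.
   Context: A polynomial $f\in\mathbb{F}_Q[x]$ is a complete permutation polynomial over $\mathbb{F}_Q$ if both $f(x)$ and $f(x)+x$ induce bijections of $\mathbb{F}_Q$. -}

module Defs where

open import Level using (Level; _⊔_)
open import Data.Nat using (ℕ; zero; suc)
open import Data.Fin using (Fin)
open import Data.Product using (∃)
open import Relation.Nullary using (¬_)
open import Relation.Binary.PropositionalEquality using (setoid)
open import Algebra.Bundles using (CommutativeRing)
open import Function.Bundles using (Bijection)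
open import Function.Definitions using (Bijective)

record IsField {c ℓ : Level} (R : CommutativeRing c ℓ) : Set (c ⊔ ℓ) where
  open CommutativeRing R
  field
    0≉1     : ¬ (0# ≈ 1#)
    inverse : ∀ x → ¬ (x ≈ 0#) → ∃ λ y → (x * y) ≈ 1#

HasCard : {c ℓ : Level} → CommutativeRing c ℓ → ℕ → Set (c ⊔ ℓ)
HasCard R Q = Bijection (CommutativeRing.setoid R) (setoid (Fin Q))

record FiniteField {c ℓ : Level} (R : CommutativeRing c ℓ) (Q : ℕ) : Set (c ⊔ ℓ) where
  field
    isField : IsField R
    card    : HasCard R Q

pow : {c ℓ : Level} (R : CommutativeRing c ℓ) → CommutativeRing.Carrier R → ℕ → CommutativeRing.Carrier R
pow R x zero    = CommutativeRing.1# R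
pow R x (suc n) = CommutativeRing._*_ R x (pow R x n)

IsPermutation : {c ℓ : Level} (R : CommutativeRing c ℓ) →
                (CommutativeRing.Carrier R → CommutativeRing.Carrier R) → Set (c ⊔ ℓ)
IsPermutation R f = Bijective (CommutativeRing._≈_ R) (CommutativeRing._≈_ R) f

IsCompletePermutation : {c ℓ : Level} (R : CommutativeRing c ℓ) →
                        (CommutativeRing.Carrier R → CommutativeRing.Carrier R) → Set (c ⊔ ℓ)
IsCompletePermutation R f =
  IsPermutation R f × IsPermutation R (λ x → CommutativeRing._+_ R (f x) x)
  where open import Data.Product using (_×_)

{-# OPTIONS --safe #-}
-- Write q = 2^m and D for the exponent, so that |F| = q² and 2(D + 1) = q² + 3q.
-- Then x (x^D)² = (x^q)³ for x ≠ 0, and applying x ↦ x^q (an involution, as x^(q²) = x)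
-- gives x^q (x^D)^(2q) = x³; combining the two, x⁸ is a function of x^D, and squaring is
-- injective in characteristic 2, so x ↦ v x^D is injective.
-- For g x = v x^D + x put A = (g x)² = v² (x^D)² + x², so that x A = v² (x^q)³ + x³.
-- Since v^(q+1) = 1 this yields x A = v² x^q A^q, and A = 0 only at x = 0 because v is not a
-- cube. So g x = g y with A ≠ 0 gives x y^q = y x^q, and then x³ y A = y³ x A, i.e. x² = y².
-- Injective self-maps of a finite set are bijective.
module Submission where

open import Defs
open import Level using (Level)
open import Algebra.Bundles using (CommutativeRing)
open import Data.Nat as ℕ using (ℕ; zero; suc; NonZero)
open import Data.Fin as Fin using (Fin; punchOut; punchIn)
open import Data.Fin.Properties using (¬Fin0; any?; pigeonhole; punchOut-injective; <⇒≢; punchInᵢ≢i)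
  renaming (_≟_ to _≟ᶠ_)
open import Data.Fin.Permutation using (Permutation)
open import Data.Nat.Properties using (n<1+n; m^n≢0)
open import Data.Product using (∃; _,_; proj₂)
open import Function.Bundles using (Bijection; mk↔ₛ′)
open import Function.Definitions using (Injective; Surjective; Bijective; Congruent)
open import Relation.Binary.Bundles using (Setoid)
open import Relation.Binary.Definitions using (Decidable)
open import Relation.Binary.PropositionalEquality as ≡ using (_≡_; _≢_)
open import Relation.Nullary using (¬_; Dec; yes; no)
open import Relation.Nullary.Negation using (contradiction)
import Algebra.Properties.CommutativeSemiring.Exp as Exp
import Algebra.Properties.Ring as RingProperties
import Algebra.Solver.Ring.NaturalCoefficients.Default as Solver
import Algebra.Properties.CommutativeMonoid.Sum as ProductProperties
import Relation.Binary.Reasoning.Setoid as SetoidReasoning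

Fin-injective⇒surjective : ∀ {n} {h : Fin n → Fin n} → Injective _≡_ _≡_ h → Surjective _≡_ _≡_ h
Fin-injective⇒surjective {zero}  _ ()
Fin-injective⇒surjective {suc n} {h} inj y with any? (λ x → h x ≟ᶠ y)
... | yes (x , hx≡y) = x , λ { ≡.refl → hx≡y }
... | no ∄x =
  let i , j , i<j , eq = pigeonhole (n<1+n n) (λ x → punchOut (hx≢y x))
  in contradiction (inj (punchOut-injective (hx≢y i) (hx≢y j) eq)) (<⇒≢ i<j)
  where
  hx≢y : ∀ x → y ≢ h x
  hx≢y x y≡hx = ∄x (x , ≡.sym y≡hx)

module FiniteSetoid {c ℓ} {S : Setoid c ℓ} {n : ℕ} (card : Bijection S (≡.setoid (Fin n))) where
  open Setoid S
  open Bijection card using (to; to⁻; injective; strictlySurjective) renaming (cong to to-cong)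

  _≟_ : Decidable _≈_
  x ≟ y with to x ≟ᶠ to y
  ... | yes eq = yes (injective eq)
  ... | no neq = no λ x≈y → neq (to-cong x≈y)

  injective⇒surjective : ∀ {f} → Congruent _≈_ _≈_ f → Injective _≈_ _≈_ f → Surjective _≈_ _≈_ f
  injective⇒surjective {f} f-cong f-inj y =
    let i , hi≡ = Fin-injective⇒surjective h-injective (to y)
    in to⁻ i , λ z≈ → trans (f-cong z≈) (injective (hi≡ ≡.refl))
    where
    h : Fin n → Fin n
    h i = to (f (to⁻ i))
    to∘to⁻ : ∀ i → to (to⁻ i) ≡ i
    to∘to⁻ i = proj₂ (strictlySurjective i)
    h-injective : Injective _≡_ _≡_ h
    h-injective {i} {j} eq =
      ≡.trans (≡.sym (to∘to⁻ i)) (≡.trans (to-cong (f-inj (injective eq))) (to∘to⁻ j))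

  injective⇒bijective : ∀ {f} → Congruent _≈_ _≈_ f → Injective _≈_ _≈_ f → Bijective _≈_ _≈_ f
  injective⇒bijective f-cong f-inj = f-inj , injective⇒surjective f-cong f-inj

module Powers {c ℓ} (F : CommutativeRing c ℓ) where
  open CommutativeRing F
  private module Lib = Exp commutativeSemiring

  infixr 8 _^_
  _^_ : Carrier → ℕ → Carrier
  x ^ n = pow F x n

  ^≡Lib^ : ∀ x n → x ^ n ≡ x Lib.^ n
  ^≡Lib^ x zero    = ≡.refl
  ^≡Lib^ x (suc n) = ≡.cong (x *_) (^≡Lib^ x n)

  ^-congˡ : ∀ n {x y} → x ≈ y → x ^ n ≈ y ^ n
  ^-congˡ n {x} {y} rewrite ^≡Lib^ x n | ^≡Lib^ y n = Lib.^-congˡ n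

  ^-homo-* : ∀ x m n → x ^ (m ℕ.+ n) ≈ x ^ m * x ^ n
  ^-homo-* x m n rewrite ^≡Lib^ x (m ℕ.+ n) | ^≡Lib^ x m | ^≡Lib^ x n = Lib.^-homo-* x m n

  ^-assocʳ : ∀ x m n → (x ^ m) ^ n ≈ x ^ (m ℕ.* n)
  ^-assocʳ x m n rewrite ^≡Lib^ x (m ℕ.* n) | ^≡Lib^ x m | ^≡Lib^ (x Lib.^ m) n = Lib.^-assocʳ x m n

  ^-distrib-* : ∀ x y n → (x * y) ^ n ≈ x ^ n * y ^ n
  ^-distrib-* x y n rewrite ^≡Lib^ (x * y) n | ^≡Lib^ x n | ^≡Lib^ y n = Lib.^-distrib-* x y n

  1^n≈1 : ∀ n → 1# ^ n ≈ 1#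
  1^n≈1 zero    = refl
  1^n≈1 (suc n) = trans (*-identityˡ _) (1^n≈1 n)

  0^n≈0 : ∀ {x} n .{{_ : NonZero n}} → x ≈ 0# → x ^ n ≈ 0#
  0^n≈0 (suc n) x≈0 = trans (*-congʳ x≈0) (zeroˡ _)

module FieldProperties {c ℓ} {F : CommutativeRing c ℓ} (isField : IsField F) where
  open CommutativeRing F
  open IsField isField
  open Powers F
  open SetoidReasoning setoid

  1≉0 : 1# ≉ 0#
  1≉0 1≈0 = 0≉1 (sym 1≈0)

  *-cancelˡ : ∀ {a x y} → a ≉ 0# → a * x ≈ a * y → x ≈ y
  *-cancelˡ {a} {x} {y} a≉0 ax≈ay with inverse a a≉0
  ... | b , ab≈1 = begin
    x            ≈⟨ cancel x ⟨
    b * (a * x)  ≈⟨ *-congˡ ax≈ay ⟩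
    b * (a * y)  ≈⟨ cancel y ⟩
    y            ∎
    where
    cancel : ∀ z → b * (a * z) ≈ z
    cancel z = begin
      b * (a * z)  ≈⟨ *-assoc b a z ⟨
      (b * a) * z  ≈⟨ *-congʳ (trans (*-comm b a) ab≈1) ⟩
      1# * z       ≈⟨ *-identityˡ z ⟩
      z            ∎

  x*y≉0 : ∀ {x y} → x ≉ 0# → y ≉ 0# → x * y ≉ 0#
  x*y≉0 {x} x≉0 y≉0 xy≈0 = y≉0 (*-cancelˡ x≉0 (trans xy≈0 (sym (zeroʳ x))))

  x^n≉0 : ∀ {x} n → x ≉ 0# → x ^ n ≉ 0#
  x^n≉0 zero    x≉0 = 1≉0
  x^n≉0 (suc n) x≉0 = x*y≉0 x≉0 (x^n≉0 n x≉0)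

module Fermat {c ℓ} {F : CommutativeRing c ℓ} (isField : IsField F)
              {n : ℕ} (card : HasCard F (suc n)) where
  open CommutativeRing F
  open IsField isField using (inverse)
  open Powers F
  open FieldProperties isField
  open FiniteSetoid card using (_≟_)
  open Bijection card using (to; to⁻; injective; strictlySurjective) renaming (cong to to-cong)
  open ProductProperties *-commutativeMonoid
    using (sum-remove; sum-permute; sum-cong-≋; ∑-distrib-+; sum-replicate) renaming (sum to ∏)
  open SetoidReasoning setoid

  element : Fin (suc n) → Carrier
  element = to⁻

  index-element : ∀ i → to (element i) ≡ i
  index-element i = proj₂ (strictlySurjective i)

  element-index : ∀ x → element (to x) ≈ x
  element-index x = injective (index-element (to x))

  i₀ : Fin (suc n)
  i₀ = to 0#

  element-punchIn≉0 : ∀ j → element (punchIn i₀ j) ≉ 0#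
  element-punchIn≉0 j e≈0 =
    punchInᵢ≢i i₀ j (≡.trans (≡.sym (index-element (punchIn i₀ j))) (to-cong e≈0))

  -- ψ replaces 0 by 1. Multiplication by x ≉ 0 permutes the field and so fixes ∏ ψ; pulling
  -- out the factor at 0 on both sides leaves xⁿ R ≈ R, with R the product of the nonzero elements.
  ψ : Carrier → Carrier
  ψ x with x ≟ 0#
  ... | yes _ = 1#
  ... | no  _ = x

  ψ-zero : ∀ {x} → x ≈ 0# → ψ x ≈ 1#
  ψ-zero {x} x≈0 with x ≟ 0#
  ... | yes _   = refl
  ... | no  x≉0 = contradiction x≈0 x≉0

  ψ-nonzero : ∀ {x} → x ≉ 0# → ψ x ≈ x
  ψ-nonzero {x} x≉0 with x ≟ 0#
  ... | yes x≈0 = contradiction x≈0 x≉0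
  ... | no  _   = refl

  ψ-cong : ∀ {x y} → x ≈ y → ψ x ≈ ψ y
  ψ-cong {x} {y} x≈y = by-cases (y ≟ 0#)
    where
    by-cases : Dec (y ≈ 0#) → ψ x ≈ ψ y
    by-cases (yes y≈0) = trans (ψ-zero (trans x≈y y≈0)) (sym (ψ-zero y≈0))
    by-cases (no  y≉0) = trans (ψ-nonzero (λ x≈0 → y≉0 (trans (sym x≈y) x≈0))) (trans x≈y (sym (ψ-nonzero y≉0)))

  ψ≉0 : ∀ x → ψ x ≉ 0#
  ψ≉0 x with x ≟ 0#
  ... | yes _   = 1≉0
  ... | no  x≉0 = x≉0

  ∏≉0 : ∀ {m} {f : Fin m → Carrier} → (∀ i → f i ≉ 0#) → ∏ f ≉ 0#
  ∏≉0 {zero}  f≉0 = 1≉0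
  ∏≉0 {suc m} f≉0 = x*y≉0 (f≉0 Fin.zero) (∏≉0 (λ i → f≉0 (Fin.suc i)))

  scaling : ∀ {x} → x ≉ 0# → Permutation (suc n) (suc n)
  scaling {x} x≉0 with inverse x x≉0
  ... | y , xy≈1 = mk↔ₛ′ (λ i → to (x * element i)) (λ i → to (y * element i))
                          (cancel x y xy≈1) (cancel y x (trans (*-comm y x) xy≈1))
    where
    cancel : ∀ a b → a * b ≈ 1# → ∀ i → to (a * element (to (b * element i))) ≡ i
    cancel a b ab≈1 i = ≡.trans (to-cong (begin
      a * element (to (b * element i))  ≈⟨ *-congˡ (element-index _) ⟩
      a * (b * element i)               ≈⟨ *-assoc a b _ ⟨
      (a * b) * element i               ≈⟨ *-congʳ ab≈1 ⟩
      1# * element i                    ≈⟨ *-identityˡ _ ⟩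
      element i                         ∎)) (index-element i)

  x^n≈1 : ∀ {x} → x ≉ 0# → x ^ n ≈ 1#
  x^n≈1 {x} x≉0 = *-cancelˡ R≉0 (begin
    R * x ^ n                                    ≈⟨ *-comm R _ ⟩
    x ^ n * R                                    ≈⟨ *-congʳ x^n≈∏x ⟩
    ∏ {n} (λ _ → x) * R                          ≈⟨ ∑-distrib-+ (λ _ → x) (λ j → ψ (element (punchIn i₀ j))) ⟨
    ∏ (λ j → x * ψ (element (punchIn i₀ j)))     ≈⟨ sum-cong-≋ {n} (λ j → sym (ψ-scale (element-punchIn≉0 j))) ⟩
    ∏ (λ j → ψ (x * element (punchIn i₀ j)))     ≈⟨ *-identityˡ _ ⟨
    1# * ∏ (λ j → ψ (x * element (punchIn i₀ j))) ≈⟨ *-congʳ (ψ-zero x*element-i₀≈0) ⟨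
    ψ (x * element i₀) * ∏ (λ j → ψ (x * element (punchIn i₀ j)))
                                                 ≈⟨ sum-remove {i = i₀} (λ i → ψ (x * element i)) ⟨
    ∏ (λ i → ψ (x * element i))                  ≈⟨ sum-cong-≋ {suc n} (λ i → ψ-cong (element-index (x * element i))) ⟨
    ∏ (λ i → ψ (element (to (x * element i))))   ≈⟨ sum-permute (λ i → ψ (element i)) (scaling x≉0) ⟨
    ∏ (λ i → ψ (element i))                      ≈⟨ sum-remove {i = i₀} (λ i → ψ (element i)) ⟩
    ψ (element i₀) * R                           ≈⟨ *-congʳ (ψ-zero (element-index 0#)) ⟩
    1# * R                                       ≈⟨ *-identityˡ R ⟩
    R                                            ≈⟨ *-identityʳ R ⟨
    R * 1#                                       ∎)
    where
    R : Carrier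
    R = ∏ (λ j → ψ (element (punchIn i₀ j)))
    R≉0 : R ≉ 0#
    R≉0 = ∏≉0 (λ j → ψ≉0 (element (punchIn i₀ j)))
    x^n≈∏x : x ^ n ≈ ∏ {n} (λ _ → x)
    x^n≈∏x = trans (reflexive (^≡Lib^ x n)) (sym (sum-replicate n))
    x*element-i₀≈0 : x * element i₀ ≈ 0#
    x*element-i₀≈0 = trans (*-congˡ (element-index 0#)) (zeroʳ x)
    ψ-scale : ∀ {y} → y ≉ 0# → ψ (x * y) ≈ x * ψ y
    ψ-scale y≉0 = trans (ψ-nonzero (x*y≉0 x≉0 y≉0)) (*-congˡ (sym (ψ-nonzero y≉0)))

  x^[1+n]≈x : ∀ x → x ^ suc n ≈ x
  x^[1+n]≈x x with x ≟ 0#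
  ... | yes x≈0 = trans (0^n≈0 (suc n) x≈0) (sym x≈0)
  ... | no  x≉0 = trans (*-congˡ (x^n≈1 x≉0)) (*-identityʳ x)

fermat : ∀ {c ℓ} {F : CommutativeRing c ℓ} → IsField F → ∀ {Q} → HasCard F Q →
         ∀ x → CommutativeRing._≈_ F (pow F x Q) x
fermat {F = F} isField {zero}  card x = contradiction (Bijection.to card (CommutativeRing.0# F)) ¬Fin0
fermat         isField {suc n} card   = Fermat.x^[1+n]≈x isField card

module EvenOrder {c ℓ} {F : CommutativeRing c ℓ} (isField : IsField F)
                 {P : ℕ} (card : HasCard F (2 ℕ.* P)) where
  open CommutativeRing F
  open Powers F
  open RingProperties ring using (-1*x≈-x; -‿involutive)
  open FieldProperties isField
  open FiniteSetoid card using (_≟_)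
  open Solver commutativeSemiring
  open SetoidReasoning setoid

  -- Fermat's little theorem at -1, whose square is 1, forces -1 ≈ 1.
  1+1≈0 : 1# + 1# ≈ 0#
  1+1≈0 = begin
    1# + 1#    ≈⟨ +-congʳ 1≈-1 ⟩
    - 1# + 1#  ≈⟨ -‿inverseˡ 1# ⟩
    0#         ∎
    where
    1≈-1 : 1# ≈ - 1#
    1≈-1 = begin
      1#                     ≈⟨ 1^n≈1 P ⟨
      1# ^ P                 ≈⟨ ^-congˡ P (trans (-1*x≈-x (- 1#)) (-‿involutive 1#)) ⟨
      (- 1# * - 1#) ^ P      ≈⟨ ^-congˡ P (*-congˡ (*-identityʳ (- 1#))) ⟨
      ((- 1#) ^ 2) ^ P       ≈⟨ ^-assocʳ (- 1#) 2 P ⟩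
      (- 1#) ^ (2 ℕ.* P)     ≈⟨ fermat isField card (- 1#) ⟩
      - 1#                   ∎

  infix 10 _²
  _² : Carrier → Carrier
  x ² = x * x

  x^2≈x² : ∀ x → x ^ 2 ≈ x ²
  x^2≈x² x = *-congˡ (*-identityʳ x)

  x+x≈0 : ∀ x → x + x ≈ 0#
  x+x≈0 x = begin
    x + x              ≈⟨ +-cong (*-identityˡ x) (*-identityˡ x) ⟨
    1# * x + 1# * x    ≈⟨ distribʳ x 1# 1# ⟨
    (1# + 1#) * x      ≈⟨ *-congʳ 1+1≈0 ⟩
    0# * x             ≈⟨ zeroˡ x ⟩
    0#                 ∎

  x+y≈0⇒x≈y : ∀ {x y} → x + y ≈ 0# → x ≈ y
  x+y≈0⇒x≈y {x} {y} x+y≈0 = begin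
    x              ≈⟨ +-identityʳ x ⟨
    x + 0#         ≈⟨ +-congˡ (x+x≈0 y) ⟨
    x + (y + y)    ≈⟨ +-assoc x y y ⟨
    (x + y) + y    ≈⟨ +-congʳ x+y≈0 ⟩
    0# + y         ≈⟨ +-identityˡ y ⟩
    y              ∎

  x≈y⇒x+y≈0 : ∀ {x y} → x ≈ y → x + y ≈ 0#
  x≈y⇒x+y≈0 {x} {y} x≈y = trans (+-congʳ x≈y) (x+x≈0 y)

  [x+y]²≈x²+y² : ∀ x y → (x + y) ² ≈ x ² + y ²
  [x+y]²≈x²+y² x y = begin
    (x + y) ²                  ≈⟨ solve 2 (λ x y → (x :+ y) :* (x :+ y) := x :* x :+ y :* y :+ (x :* y :+ x :* y)) refl x y ⟩
    x ² + y ² + (x * y + x * y) ≈⟨ +-congˡ (x+x≈0 (x * y)) ⟩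
    x ² + y ² + 0#              ≈⟨ +-identityʳ _ ⟩
    x ² + y ²                   ∎

  x²≈0⇒x≈0 : ∀ {x} → x ² ≈ 0# → x ≈ 0#
  x²≈0⇒x≈0 {x} x²≈0 with x ≟ 0#
  ... | yes x≈0 = x≈0
  ... | no  x≉0 = contradiction x²≈0 (x*y≉0 x≉0 x≉0)

  ²-injective : ∀ {x y} → x ² ≈ y ² → x ≈ y
  ²-injective {x} {y} x²≈y² = x+y≈0⇒x≈y (x²≈0⇒x≈0 (trans ([x+y]²≈x²+y² x y) (x≈y⇒x+y≈0 x²≈y²)))

  frobenius : ∀ j x y → (x + y) ^ (2 ℕ.^ j) ≈ x ^ (2 ℕ.^ j) + y ^ (2 ℕ.^ j)
  frobenius zero x y = trans (*-identityʳ _) (sym (+-cong (*-identityʳ x) (*-identityʳ y)))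
  frobenius (suc j) x y = begin
    (x + y) ^ (2 ℕ.* J)          ≈⟨ ^-assocʳ (x + y) 2 J ⟨
    ((x + y) ^ 2) ^ J            ≈⟨ ^-congˡ J (trans (x^2≈x² (x + y)) ([x+y]²≈x²+y² x y)) ⟩
    (x ² + y ²) ^ J              ≈⟨ frobenius j (x ²) (y ²) ⟩
    (x ²) ^ J + (y ²) ^ J        ≈⟨ +-cong (^-congˡ J (x^2≈x² x)) (^-congˡ J (x^2≈x² y)) ⟨
    (x ^ 2) ^ J + (y ^ 2) ^ J    ≈⟨ +-cong (^-assocʳ x 2 J) (^-assocʳ y 2 J) ⟩
    x ^ (2 ℕ.* J) + y ^ (2 ℕ.* J) ∎
    where
    J : ℕ
    J = 2 ℕ.^ j

module Exponent where
  open import Data.Nat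
  open import Data.Nat.Properties
  open import Data.Nat.Tactic.RingSolver using (solve-∀)
  open ≡.≡-Reasoning

  exponent : ℕ → ℕ
  exponent m = 2 ^ (2 * m ∸ 1) + 2 ^ m + 2 ^ (m ∸ 1) ∸ 1

  2^[2m]≡2^m*2^m : ∀ m → 2 ^ (2 * m) ≡ 2 ^ m * 2 ^ m
  2^[2m]≡2^m*2^m m = ≡.trans (≡.cong (λ n → 2 ^ (m + n)) (+-identityʳ m)) (^-distribˡ-+-* 2 m m)

  2[1+exponent]≡q²+3q : ∀ k → let q = 2 ^ suc k in suc (exponent (suc k)) * 2 ≡ q * q + q * 3
  2[1+exponent]≡q²+3q k = begin
    suc (pred S) * 2              ≡⟨ ≡.cong (_* 2) (suc-pred S {{>-nonZero 0<S}}) ⟩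
    S * 2                         ≡⟨ ≡.cong (λ b → (b + 2 * a + a) * 2) 2^[2k+1]≡2a² ⟩
    (2 * (a * a) + 2 * a + a) * 2 ≡⟨ identity a ⟩
    2 * a * (2 * a) + 2 * a * 3   ∎
    where
    a S : ℕ
    a = 2 ^ k
    S = 2 ^ (2 * suc k ∸ 1) + 2 * a + a
    0<S : 0 < S
    0<S = ≤-trans (m^n>0 2 k) (m≤n+m a _)
    2^[2k+1]≡2a² : 2 ^ (2 * suc k ∸ 1) ≡ 2 * (a * a)
    2^[2k+1]≡2a² = ≡.trans (≡.cong (2 ^_) (≡.trans (≡.cong (k +_) (+-identityʳ (suc k))) (+-suc k k)))
                           (≡.cong (2 *_) (^-distribˡ-+-* 2 k k))
    identity : ∀ a → (2 * (a * a) + 2 * a + a) * 2 ≡ 2 * a * (2 * a) + 2 * a * 3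
    identity = solve-∀

  2[D+1]≡q²+3q⇒D≢0 : ∀ {D q} .{{_ : NonZero q}} → suc D * 2 ≡ q * q + q * 3 → NonZero D
  2[D+1]≡q²+3q⇒D≢0 {suc D}         _  = _
  2[D+1]≡q²+3q⇒D≢0 {zero} {suc q} eq =
    contradiction (≤-trans (m≤n+m (suc q * 3) (suc q * suc q)) (≤-reflexive (≡.sym eq))) λ { (s≤s (s≤s ())) }

open Exponent

module CompleteMonomial {c ℓ} {F : CommutativeRing c ℓ} (isField : IsField F)
                        (k : ℕ) (card : HasCard F (2 ℕ.^ (2 ℕ.* suc k))) where
  open CommutativeRing F
  open Powers F
  open FieldProperties isField
  open FiniteSetoid card using (_≟_; injective⇒bijective)
  open EvenOrder isField {2 ℕ.^ (2 ℕ.* suc k ℕ.∸ 1)} card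
  open Solver commutativeSemiring
  open SetoidReasoning setoid

  m q D : ℕ
  m = suc k
  q = 2 ℕ.^ m
  D = exponent m

  x^[q²]≈x : ∀ x → x ^ (q ℕ.* q) ≈ x
  x^[q²]≈x x = trans (reflexive (≡.cong (x ^_) (≡.sym (2^[2m]≡2^m*2^m m)))) (fermat isField card x)

  instance
    D≢0 : NonZero D
    D≢0 = 2[D+1]≡q²+3q⇒D≢0 {{m^n≢0 2 m}} (2[1+exponent]≡q²+3q k)

  infix 10 _³
  _³ : Carrier → Carrier
  x ³ = x ² * x

  x^3≈x³ : ∀ x → x ^ 3 ≈ x ³
  x^3≈x³ x = solve 1 (λ x → x :* (x :* (x :* con 1)) := x :* x :* x) refl x

  [x³]ⁿ≈[xⁿ]³ : ∀ x n → (x ³) ^ n ≈ (x ^ n) ³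
  [x³]ⁿ≈[xⁿ]³ x n = trans (^-distrib-* (x ²) x n) (*-congʳ (^-distrib-* x x n))

  [xᵠ]ᵠ≈x : ∀ x → (x ^ q) ^ q ≈ x
  [xᵠ]ᵠ≈x x = trans (^-assocʳ x q q) (x^[q²]≈x x)

  x*[xᴰ]²≈[xᵠ]³ : ∀ {x} → x ≉ 0# → x * (x ^ D) ² ≈ (x ^ q) ³
  x*[xᴰ]²≈[xᵠ]³ {x} x≉0 = *-cancelˡ x≉0 (begin
    x * (x * (x ^ D) ²)        ≈⟨ solve 2 (λ x t → x :* (x :* (t :* t)) := (x :* t) :* (x :* t)) refl x (x ^ D) ⟩
    (x ^ suc D) ²              ≈⟨ x^2≈x² (x ^ suc D) ⟨
    (x ^ suc D) ^ 2            ≈⟨ ^-assocʳ x (suc D) 2 ⟩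
    x ^ (suc D ℕ.* 2)          ≡⟨ ≡.cong (x ^_) (2[1+exponent]≡q²+3q k) ⟩
    x ^ (q ℕ.* q ℕ.+ q ℕ.* 3)  ≈⟨ ^-homo-* x (q ℕ.* q) (q ℕ.* 3) ⟩
    x ^ (q ℕ.* q) * x ^ (q ℕ.* 3) ≈⟨ *-cong (x^[q²]≈x x) (trans (sym (^-assocʳ x q 3)) (x^3≈x³ (x ^ q))) ⟩
    x * (x ^ q) ³              ∎)

  xᵠ*[xᴰ]²ᵠ≈x³ : ∀ {x} → x ≉ 0# → x ^ q * ((x ^ D) ²) ^ q ≈ x ³
  xᵠ*[xᴰ]²ᵠ≈x³ {x} x≉0 = begin
    x ^ q * ((x ^ D) ²) ^ q    ≈⟨ ^-distrib-* x ((x ^ D) ²) q ⟨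
    (x * (x ^ D) ²) ^ q        ≈⟨ ^-congˡ q (x*[xᴰ]²≈[xᵠ]³ x≉0) ⟩
    ((x ^ q) ³) ^ q            ≈⟨ [x³]ⁿ≈[xⁿ]³ (x ^ q) q ⟩
    ((x ^ q) ^ q) ³            ≈⟨ *-cong (*-cong ([xᵠ]ᵠ≈x x) ([xᵠ]ᵠ≈x x)) ([xᵠ]ᵠ≈x x) ⟩
    x ³                        ∎

  x⁸≈[xᴰ]²*[[xᴰ]²ᵠ]³ : ∀ {x} → x ≉ 0# → ((x ²) ²) ² ≈ (x ^ D) ² * (((x ^ D) ²) ^ q) ³
  x⁸≈[xᴰ]²*[[xᴰ]²ᵠ]³ {x} x≉0 = *-cancelˡ x≉0 (begin
    x * ((x ²) ²) ²            ≈⟨ solve 1 (λ x → x :* ((x :* x :* (x :* x)) :* (x :* x :* (x :* x))) := (x :* x :* x) :* (x :* x :* x) :* (x :* x :* x)) refl x ⟩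
    (x ³) ³                    ≈⟨ *-cong (*-cong x³≈ x³≈) x³≈ ⟨
    (x ^ q * sᵠ) ³             ≈⟨ solve 2 (λ a b → (a :* b) :* (a :* b) :* (a :* b) := (a :* a :* a) :* (b :* b :* b)) refl (x ^ q) sᵠ ⟩
    (x ^ q) ³ * sᵠ ³           ≈⟨ *-congʳ (x*[xᴰ]²≈[xᵠ]³ x≉0) ⟨
    (x * (x ^ D) ²) * sᵠ ³     ≈⟨ *-assoc x _ _ ⟩
    x * ((x ^ D) ² * sᵠ ³)     ∎)
    where
    sᵠ : Carrier
    sᵠ = ((x ^ D) ²) ^ q
    x³≈ : x ^ q * sᵠ ≈ x ³
    x³≈ = xᵠ*[xᴰ]²ᵠ≈x³ x≉0

  xᴰ≈0⇒x≈0 : ∀ {x} → x ^ D ≈ 0# → x ≈ 0#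
  xᴰ≈0⇒x≈0 {x} xᴰ≈0 with x ≟ 0#
  ... | yes x≈0 = x≈0
  ... | no  x≉0 = contradiction xᴰ≈0 (x^n≉0 D x≉0)

  ^D-injective : ∀ {x y} → x ^ D ≈ y ^ D → x ≈ y
  ^D-injective {x} {y} xᴰ≈yᴰ with x ≟ 0# | y ≟ 0#
  ... | yes x≈0 | _       = trans x≈0 (sym (xᴰ≈0⇒x≈0 (trans (sym xᴰ≈yᴰ) (0^n≈0 D x≈0))))
  ... | no  x≉0 | yes y≈0 = contradiction (xᴰ≈0⇒x≈0 (trans xᴰ≈yᴰ (0^n≈0 D y≈0))) x≉0
  ... | no  x≉0 | no  y≉0 = ²-injective (²-injective (²-injective (begin
    ((x ²) ²) ²                              ≈⟨ x⁸≈[xᴰ]²*[[xᴰ]²ᵠ]³ x≉0 ⟩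
    (x ^ D) ² * (((x ^ D) ²) ^ q) ³          ≈⟨ *-cong s≈ (*-cong (*-cong sᵠ≈ sᵠ≈) sᵠ≈) ⟩
    (y ^ D) ² * (((y ^ D) ²) ^ q) ³          ≈⟨ x⁸≈[xᴰ]²*[[xᴰ]²ᵠ]³ y≉0 ⟨
    ((y ²) ²) ²                              ∎)))
    where
    s≈ : (x ^ D) ² ≈ (y ^ D) ²
    s≈ = *-cong xᴰ≈yᴰ xᴰ≈yᴰ
    sᵠ≈ : ((x ^ D) ²) ^ q ≈ ((y ^ D) ²) ^ q
    sᵠ≈ = ^-congˡ q s≈

  module _ (v : Carrier) (v≉0 : v ≉ 0#) (v-noncube : ¬ ∃ λ y → v ≈ y ^ 3)
           (v^[q+1]≈1 : v ^ (q ℕ.+ 1) ≈ 1#) where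

    w : Carrier
    w = v ²

    g : Carrier → Carrier
    g x = v * x ^ D + x

    A : Carrier → Carrier
    A x = (g x) ²

    g-cong : ∀ {x y} → x ≈ y → g x ≈ g y
    g-cong x≈y = +-cong (*-congˡ (^-congˡ D x≈y)) x≈y

    x≈0⇒A≈0 : ∀ {x} → x ≈ 0# → A x ≈ 0#
    x≈0⇒A≈0 {x} x≈0 = trans (*-cong gx≈0 gx≈0) (zeroˡ 0#)
      where
      gx≈0 : g x ≈ 0#
      gx≈0 = trans (+-cong (trans (*-congˡ (0^n≈0 D x≈0)) (zeroʳ v)) x≈0) (+-identityʳ 0#)

    A≉0⇒x≉0 : ∀ {x} → A x ≉ 0# → x ≉ 0#
    A≉0⇒x≉0 Ax≉0 x≈0 = Ax≉0 (x≈0⇒A≈0 x≈0)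

    A≈w[xᴰ]²+x² : ∀ x → A x ≈ w * (x ^ D) ² + x ²
    A≈w[xᴰ]²+x² x = trans ([x+y]²≈x²+y² (v * x ^ D) x)
      (+-congʳ (solve 2 (λ v t → (v :* t) :* (v :* t) := (v :* v) :* (t :* t)) refl v (x ^ D)))

    x*A≈w[xᵠ]³+x³ : ∀ {x} → x ≉ 0# → x * A x ≈ w * (x ^ q) ³ + x ³
    x*A≈w[xᵠ]³+x³ {x} x≉0 = begin
      x * A x                    ≈⟨ *-congˡ (A≈w[xᴰ]²+x² x) ⟩
      x * (w * (x ^ D) ² + x ²)  ≈⟨ solve 3 (λ x w s → x :* (w :* s :+ x :* x) := w :* (x :* s) :+ x :* x :* x) refl x w ((x ^ D) ²) ⟩
      w * (x * (x ^ D) ²) + x ³  ≈⟨ +-congʳ (*-congˡ (x*[xᴰ]²≈[xᵠ]³ x≉0)) ⟩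
      w * (x ^ q) ³ + x ³        ∎

    w*wᵠ≈1 : w * w ^ q ≈ 1#
    w*wᵠ≈1 = begin
      w * w ^ q                     ≈⟨ *-congˡ (^-distrib-* v v q) ⟩
      v ² * (v ^ q * v ^ q)          ≈⟨ solve 2 (λ a b → (a :* a) :* (b :* b) := (a :* b) :* (a :* b)) refl v (v ^ q) ⟩
      (v * v ^ q) * (v * v ^ q)      ≈⟨ *-cong v*vᵠ≈1 v*vᵠ≈1 ⟩
      1# * 1#                        ≈⟨ *-identityˡ 1# ⟩
      1#                             ∎
      where
      v*vᵠ≈1 : v * v ^ q ≈ 1#
      v*vᵠ≈1 = begin
        v * v ^ q      ≈⟨ *-comm v (v ^ q) ⟩
        v ^ q * v      ≈⟨ *-congˡ (*-identityʳ v) ⟨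
        v ^ q * v ^ 1  ≈⟨ ^-homo-* v q 1 ⟨
        v ^ (q ℕ.+ 1)  ≈⟨ v^[q+1]≈1 ⟩
        1#             ∎

    w*xᵠ*Aᵠ≈x*A : ∀ {x} → x ≉ 0# → w * (x ^ q * A x ^ q) ≈ x * A x
    w*xᵠ*Aᵠ≈x*A {x} x≉0 = begin
      w * (xᵠ * A x ^ q)                               ≈⟨ *-congˡ (*-congˡ (^-congˡ q (A≈w[xᴰ]²+x² x))) ⟩
      w * (xᵠ * (w * s + x ²) ^ q)                     ≈⟨ *-congˡ (*-congˡ (frobenius m (w * s) (x ²))) ⟩
      w * (xᵠ * ((w * s) ^ q + (x ²) ^ q))             ≈⟨ *-congˡ (*-congˡ (+-cong (^-distrib-* w s q) (^-distrib-* x x q))) ⟩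
      w * (xᵠ * (w ^ q * s ^ q + xᵠ * xᵠ))             ≈⟨ solve 4 (λ w wq a b → w :* (a :* (wq :* b :+ a :* a)) := (w :* wq) :* (a :* b) :+ w :* (a :* a :* a)) refl w (w ^ q) xᵠ (s ^ q) ⟩
      (w * w ^ q) * (xᵠ * s ^ q) + w * xᵠ ³            ≈⟨ +-congʳ (*-cong w*wᵠ≈1 (xᵠ*[xᴰ]²ᵠ≈x³ x≉0)) ⟩
      1# * x ³ + w * xᵠ ³                              ≈⟨ trans (+-congʳ (*-identityˡ _)) (+-comm _ _) ⟩
      w * xᵠ ³ + x ³                                   ≈⟨ x*A≈w[xᵠ]³+x³ x≉0 ⟨
      x * A x                                          ∎
      where
      xᵠ s : Carrier
      xᵠ = x ^ q
      s = (x ^ D) ²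

    -- If A x ≈ 0 then w * (xᵠ)³ ≈ x³, so v ≈ (v * xᵠ / x)³.
    A≉0 : ∀ {x} → x ≉ 0# → A x ≉ 0#
    A≉0 {x} x≉0 Ax≈0 with IsField.inverse isField x x≉0
    ... | z , xz≈1 = v-noncube (v * x ^ q * z , (begin
      v                                ≈⟨ solve 1 (λ v → v := v :* (con 1 :* con 1 :* con 1)) refl v ⟩
      v * (1# * 1# * 1#)               ≈⟨ *-congˡ (*-cong (*-cong xz≈1 xz≈1) xz≈1) ⟨
      v * (x * z) ³                    ≈⟨ solve 3 (λ v x z → v :* ((x :* z) :* (x :* z) :* (x :* z)) := v :* (x :* x :* x) :* (z :* z :* z)) refl v x z ⟩
      v * x ³ * z ³                    ≈⟨ *-congʳ (*-congˡ w[xᵠ]³≈x³) ⟨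
      v * (w * (x ^ q) ³) * z ³        ≈⟨ solve 3 (λ v a z → v :* ((v :* v) :* (a :* a :* a)) :* (z :* z :* z) := (v :* a :* z) :* ((v :* a :* z) :* ((v :* a :* z) :* con 1))) refl v (x ^ q) z ⟩
      (v * x ^ q * z) ^ 3              ∎))
      where
      w[xᵠ]³≈x³ : w * (x ^ q) ³ ≈ x ³
      w[xᵠ]³≈x³ = x+y≈0⇒x≈y (trans (sym (x*A≈w[xᵠ]³+x³ x≉0)) (trans (*-congˡ Ax≈0) (zeroʳ x)))

    A≈0⇒x≈0 : ∀ {x} → A x ≈ 0# → x ≈ 0#
    A≈0⇒x≈0 {x} Ax≈0 with x ≟ 0#
    ... | yes x≈0 = x≈0
    ... | no  x≉0 = contradiction Ax≈0 (A≉0 x≉0)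

    x*yᵠ≈y*xᵠ : ∀ {x y} → A x ≈ A y → A x ≉ 0# → x * y ^ q ≈ y * x ^ q
    x*yᵠ≈y*xᵠ {x} {y} Ax≈Ay a≉0 = *-cancelˡ w*a*aᵠ≉0 (begin
      w * (a * aᵠ) * (x * y ^ q)       ≈⟨ solve 5 (λ w a aq x yq → w :* (a :* aq) :* (x :* yq) := (x :* a) :* (w :* (yq :* aq))) refl w a aᵠ x (y ^ q) ⟩
      (x * a) * (w * (y ^ q * aᵠ))     ≈⟨ *-cong (sym (w*xᵠ*Aᵠ≈x*A x≉0)) w*yᵠ*aᵠ≈y*a ⟩
      (w * (x ^ q * aᵠ)) * (y * a)     ≈⟨ solve 5 (λ w a aq y xq → (w :* (xq :* aq)) :* (y :* a) := w :* (a :* aq) :* (y :* xq)) refl w a aᵠ y (x ^ q) ⟩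
      w * (a * aᵠ) * (y * x ^ q)       ∎)
      where
      a aᵠ : Carrier
      a = A x
      aᵠ = a ^ q
      x≉0 : x ≉ 0#
      x≉0 = A≉0⇒x≉0 a≉0
      y≉0 : y ≉ 0#
      y≉0 = A≉0⇒x≉0 (λ Ay≈0 → a≉0 (trans Ax≈Ay Ay≈0))
      w*yᵠ*aᵠ≈y*a : w * (y ^ q * aᵠ) ≈ y * a
      w*yᵠ*aᵠ≈y*a = trans (*-congˡ (*-congˡ (^-congˡ q Ax≈Ay))) (trans (w*xᵠ*Aᵠ≈x*A y≉0) (*-congˡ (sym Ax≈Ay)))
      w*a*aᵠ≉0 : w * (a * aᵠ) ≉ 0#
      w*a*aᵠ≉0 = x*y≉0 (x*y≉0 v≉0 v≉0) (x*y≉0 a≉0 (x^n≉0 q a≉0))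

    -- Cubing x * yᵠ ≈ y * xᵠ turns x³ * (y * a) into y³ * (x * a); cancelling x * y * a leaves x² ≈ y².
    g-injective : ∀ {x y} → g x ≈ g y → x ≈ y
    g-injective {x} {y} gx≈gy with A x ≟ 0#
    ... | yes Ax≈0 = trans (A≈0⇒x≈0 Ax≈0) (sym (A≈0⇒x≈0 (trans (sym (*-cong gx≈gy gx≈gy)) Ax≈0)))
    ... | no  a≉0  = ²-injective (*-cancelˡ x*y*a≉0 (begin
      (x * y * a) * x ²                ≈⟨ solve 3 (λ x y a → (x :* y :* a) :* (x :* x) := (x :* x :* x) :* (y :* a)) refl x y a ⟩
      x ³ * (y * a)                    ≈⟨ *-congˡ (trans (*-congˡ Ax≈Ay) (x*A≈w[xᵠ]³+x³ y≉0)) ⟩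
      x ³ * (w * (y ^ q) ³ + y ³)      ≈⟨ solve 5 (λ x y w yq xq → (x :* x :* x) :* (w :* (yq :* yq :* yq) :+ y :* y :* y) := w :* ((x :* yq) :* (x :* yq) :* (x :* yq)) :+ (y :* y :* y) :* (x :* x :* x)) refl x y w (y ^ q) (x ^ q) ⟩
      w * (x * y ^ q) ³ + y ³ * x ³    ≈⟨ +-congʳ (*-congˡ (*-cong (*-cong xyᵠ≈yxᵠ xyᵠ≈yxᵠ) xyᵠ≈yxᵠ)) ⟩
      w * (y * x ^ q) ³ + y ³ * x ³    ≈⟨ solve 5 (λ x y w yq xq → w :* ((y :* xq) :* (y :* xq) :* (y :* xq)) :+ (y :* y :* y) :* (x :* x :* x) := (y :* y :* y) :* (w :* (xq :* xq :* xq) :+ x :* x :* x)) refl x y w (y ^ q) (x ^ q) ⟩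
      y ³ * (w * (x ^ q) ³ + x ³)      ≈⟨ *-congˡ (x*A≈w[xᵠ]³+x³ x≉0) ⟨
      y ³ * (x * a)                    ≈⟨ solve 3 (λ x y a → (y :* y :* y) :* (x :* a) := (x :* y :* a) :* (y :* y)) refl x y a ⟩
      (x * y * a) * y ²                ∎))
      where
      a : Carrier
      a = A x
      Ax≈Ay : a ≈ A y
      Ax≈Ay = *-cong gx≈gy gx≈gy
      x≉0 : x ≉ 0#
      x≉0 = A≉0⇒x≉0 a≉0
      y≉0 : y ≉ 0#
      y≉0 = A≉0⇒x≉0 (λ Ay≈0 → a≉0 (trans Ax≈Ay Ay≈0))
      xyᵠ≈yxᵠ : x * y ^ q ≈ y * x ^ q
      xyᵠ≈yxᵠ = x*yᵠ≈y*xᵠ Ax≈Ay a≉0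
      x*y*a≉0 : x * y * a ≉ 0#
      x*y*a≉0 = x*y≉0 (x*y≉0 x≉0 y≉0) a≉0

    v*xᴰ-injective : ∀ {x y} → v * x ^ D ≈ v * y ^ D → x ≈ y
    v*xᴰ-injective vxᴰ≈vyᴰ = ^D-injective (*-cancelˡ v≉0 vxᴰ≈vyᴰ)

    v*xᴰ-complete : IsCompletePermutation F (λ x → v * x ^ D)
    v*xᴰ-complete = injective⇒bijective (λ x≈y → *-congˡ (^-congˡ D x≈y)) v*xᴰ-injective
                  , injective⇒bijective g-cong g-injective

open import Data.Nat using (_+_; _*_; _∸_; _^_; _≤_; _%_)

theorem9 : {c ℓ : Level} (m : ℕ) → 3 ≤ m → m % 2 ≡ 1 →
    (F : CommutativeRing c ℓ) → FiniteField F (2 ^ (2 * m)) →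
    (v : CommutativeRing.Carrier F) →
    ¬ (CommutativeRing._≈_ F v (CommutativeRing.0# F)) →
    ¬ (∃ λ y → CommutativeRing._≈_ F v (pow F y 3)) →
    CommutativeRing._≈_ F (pow F v (2 ^ m + 1)) (CommutativeRing.1# F) →
    IsCompletePermutation F
      (λ x → CommutativeRing._*_ F v (pow F x (2 ^ (2 * m ∸ 1) + 2 ^ m + 2 ^ (m ∸ 1) ∸ 1)))
theorem9 (suc k) _ _ F ff =
  CompleteMonomial.v*xᴰ-complete (FiniteField.isField ff) k (FiniteField.card ff)
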